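{- Let $n\ge0$, $\mathbf{x}=(x_1,\dots,x_n)$, $z$ a variable, and $\lambda=(\lambda_1,\dots,\lambda_{n+1})$ a partition (trailing zeros allowed). Then $$sp_\lambda(\mathbf{x}^{\pm};z)=\sum_{\varepsilon\in\{0,1\}^{n+1}}(-z^{ -1})^{|\varepsilon|}\,sp_{(\lambda_1-\varepsilon_1,\dots,\lambda_{n+1}-\varepsilon_{n+1})}(x_1^{\pm},\dots,x_n^{\pm},z^{\pm}),$$ where $|\varepsilon|=\varepsilon_1+\dots+\varepsilon_{n+1}$.
   Context: The odd symplectic character is $sp_\lambda(\mathbf{x}^{\pm};z)=\det(a_{ij})_{i,j=1}^{n+1}/\det(b_{ij})_{i,j=1}^{n+1}$ with $a_{ij}=x_i^{\lambda_j+n-j+2}-x_i^{ -\lambda_j-(n-j+2)}-z^{ -1}\big(x_i^{\lambda_j+n-j+1}-x_i^{ -\lambda_j-(n-j+1)}\big)$ for $1\le i\le n$, $a_{n+1,j}=z^{\lambda_j+n-j+2}-z^{\lambda_j+n-j}$, $b_{ij}=x_i^{n-j+2}-x_i^{ -(n-j+2)}$ for $1\le i\le n$, $b_{n+1,j}=z^{n-j+2}-z^{ -(n-j+2)}$. For variables $y_1,\dots,y_{n+1}$ (here $y_i=x_i$ for $i\le n$, $y_{n+1}=z$) and an integer sequence $\mu=(\mu_1,\dots,\mu_{n+1})$, $sp_\mu(y_1^{\pm},\dots,y_{n+1}^{\pm})=\det\big(y_i^{\mu_j+n-j+2}-y_i^{ -(\mu_j+n-j+2)}\big)_{i,j=1}^{n+1}/\det\big(y_i^{n-j+2}-y_i^{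 -(n-j+2)}\big)_{i,j=1}^{n+1}$; for a partition $\mu$ this is the symplectic Schur function, and it vanishes for the sequences $\lambda-\varepsilon$ that are not partitions (so only terms with $\lambda-\varepsilon$ a partition contribute). -}

module Defs where

open import Level using (Level)
open import Data.Nat as ℕ using (ℕ; zero; suc; _∸_)
open import Data.Integer as ℤ using (ℤ; +_; -[1+_])
open import Data.Fin as Fin using (Fin; zero; suc; toℕ)
open import Data.Bool using (Bool; true; false)
open import Algebra.Bundles using (CommutativeRing)

snoc : ∀ {a} {A : Set a} {n : ℕ} → (Fin n → A) → A → Fin (suc n) → A
snoc {n = zero}  f a zero    = a
snoc {n = suc n} f a zero    = f zero
snoc {n = suc n} f a (suc i) = snoc (λ k → f (suc k)) a i

consB : {n : ℕ} → Bool → (Fin n → Bool) → Fin (suc n) → Bool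
consB b e zero    = b
consB b e (suc i) = e i

weight : {n : ℕ} → (Fin n → Bool) → ℕ
weight {zero}  e = 0
weight {suc n} e = (if0 (e zero)) ℕ.+ weight (λ i → e (suc i))
  where
  if0 : Bool → ℕ
  if0 true  = 1
  if0 false = 0

bitℤ : Bool → ℤ
bitℤ true  = + 1
bitℤ false = + 0

IsPartition : {m : ℕ} → (Fin m → ℕ) → Set
IsPartition {m} λ' = ∀ (i j : Fin m) → i Fin.≤ j → λ' j ℕ.≤ λ' i

module _ {c ℓ} (R : CommutativeRing c ℓ) where
  open CommutativeRing R using (Carrier; _+_; _*_; -_; _-_; 0#; 1#)

  powℕ : Carrier → ℕ → Carrier
  powℕ u zero    = 1#
  powℕ u (suc k) = u * powℕ u k

  powℤ : Carrier → Carrier → ℤ → Carrier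
  powℤ u uinv (+ k)      = powℕ u k
  powℤ u uinv -[1+ k ]   = powℕ uinv (suc k)

  sumFin : {n : ℕ} → (Fin n → Carrier) → Carrier
  sumFin {zero}  f = 0#
  sumFin {suc n} f = f zero + sumFin (λ i → f (suc i))

  altSum : {n : ℕ} → (Fin n → Carrier) → Carrier
  altSum {zero}  f = 0#
  altSum {suc n} f = f zero - altSum (λ i → f (suc i))

  det : {n : ℕ} → (Fin n → Fin n → Carrier) → Carrier
  det {zero}  M = 1#
  det {suc n} M = altSum (λ i → M i zero * det (λ r c' → M (Fin.punchIn i r) (suc c')))

  sumBits : {n : ℕ} → ((Fin n → Bool) → Carrier) → Carrier
  sumBits {zero}  F = F (λ ())
  sumBits {suc n} F = sumBits (λ e → F (consB false e)) + sumBits (λ e → F (consB true e))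

  -- Notation: N = n+1 variables y_1..y_N with y_i = x_i (i ≤ n), y_N = z.
  -- Column j (1-based) corresponds to j' = toℕ of a Fin N index, so n - j + 2 = N - j'.

  antisym : Carrier → Carrier → ℤ → Carrier
  antisym y yinv k = powℤ y yinv k - powℤ y yinv (ℤ.- k)

  expo : {N : ℕ} → (Fin N → ℤ) → Fin N → ℤ
  expo {N} μ j = μ j ℤ.+ + (N ∸ toℕ j)

  oddNumMat : {n : ℕ} → (Fin n → Carrier) → (Fin n → Carrier) → Carrier → Carrier
            → (Fin (suc n) → ℕ) → Fin (suc n) → Fin (suc n) → Carrier
  oddNumMat {n} x xinv z zinv λ' =
    snoc (λ i j → antisym (x i) (xinv i) (expo μ j)
                  - zinv * antisym (x i) (xinv i) (expo μ j ℤ.- + 1))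
         (λ j → powℤ z zinv (expo μ j) - powℤ z zinv (expo μ j ℤ.- + 2))
    where
    μ : Fin (suc n) → ℤ
    μ j = + (λ' j)

  spNumMat : {N : ℕ} → (Fin N → Carrier) → (Fin N → Carrier) → (Fin N → ℤ)
           → Fin N → Fin N → Carrier
  spNumMat y yinv μ i j = antisym (y i) (yinv i) (expo μ j)

  denMat : {N : ℕ} → (Fin N → Carrier) → (Fin N → Carrier) → Fin N → Fin N → Carrier
  denMat y yinv = spNumMat y yinv (λ _ → + 0)

  -- sp_μ(y^±) = det(numerator) / det(denominator), where dinv is an inverse of
  -- the denominator determinant
  spChar : {N : ℕ} → (y yinv : Fin N → Carrier) → (dinv : Carrier) → (Fin N → ℤ) → Carrier
  spChar y yinv dinv μ = det (spNumMat y yinv μ) * dinv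

  oddSpChar : {n : ℕ} → (x xinv : Fin n → Carrier) → (z zinv dinv : Carrier)
            → (Fin (suc n) → ℕ) → Carrier
  oddSpChar x xinv z zinv dinv λ' = det (oddNumMat x xinv z zinv λ') * dinv

minusBits : {N : ℕ} → (Fin N → ℕ) → (Fin N → Bool) → Fin N → ℤ
minusBits λ' ε j = + (λ' j) ℤ.- bitℤ (ε j)

{-# OPTIONS --safe #-}
-- For a unit z and any integer e,  z^e − z^(e−2) = (z^e − z^(−e)) − z⁻¹ (z^(e−1) − z^(1−e)).
-- Hence every row of the odd numerator matrix, the z-row included, is a row of A − z⁻¹B,
-- where A and B are the symplectic numerator matrices of λ and of λ − (1,…,1) in the
-- variables x₁,…,xₙ,z.  Expanding det(A − z⁻¹B) multilinearly in the columns gives a sum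
-- over ε ∈ {0,1}^(n+1) of (−z⁻¹)^|ε| times the determinant taking column j from B exactly
-- when ε_j = 1, which is the numerator of sp_(λ−ε).
module Submission where

open import Defs
open import Data.Nat using (ℕ; suc; zero; _∸_)
open import Data.Integer using (+_; -[1+_])
open import Data.Fin using (Fin; zero; suc)
open import Algebra.Bundles using (CommutativeRing)

import Data.Integer as ℤ
import Data.Integer.Properties as ℤ
import Data.Nat.Properties as ℕ
import Data.Integer.Tactic.RingSolver as ℤ-Solver
import Data.Fin as Fin
open import Data.Bool using (Bool; true; false; if_then_else_)
open import Data.Maybe using (nothing)
open import Relation.Binary.PropositionalEquality as ≡ using (_≡_)
open import Tactic.RingSolver.Core.AlmostCommutativeRing using (fromCommutativeRing)
import Tactic.RingSolver.NonReflective as RingSolver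

snoc-all₃ : ∀ {a b d q} {A : Set a} {B : Set b} {D : Set d} {n : ℕ}
  (Q : A → B → D → Set q) {f : Fin n → A} {g : Fin n → B} {h : Fin n → D} {x : A} {y : B} {w : D}
  → (∀ i → Q (f i) (g i) (h i)) → Q x y w → ∀ r → Q (snoc f x r) (snoc g y r) (snoc h w r)
snoc-all₃ {n = zero}  Q hf hl zero    = hl
snoc-all₃ {n = suc n} Q hf hl zero    = hf zero
snoc-all₃ {n = suc n} Q hf hl (suc r) = snoc-all₃ Q (λ i → hf (suc i)) hl r

pred-+ : ∀ m t → (m ℤ.+ t) ℤ.- + 1 ≡ (m ℤ.- + 1) ℤ.+ t
pred-+ = ℤ-Solver.solve-∀

pred-pred : ∀ e → (e ℤ.- + 1) ℤ.- + 1 ≡ e ℤ.- + 2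
pred-pred = ℤ-Solver.solve-∀

neg-pred-pred : ∀ e → ℤ.- (e ℤ.- + 1) ℤ.- + 1 ≡ ℤ.- e
neg-pred-pred = ℤ-Solver.solve-∀

module _ {c ℓ} (R : CommutativeRing c ℓ) where
  open CommutativeRing R hiding (zero)
  open import Relation.Binary.Reasoning.Setoid setoid
  open import Algebra.Properties.Ring ring using (-‿distribˡ-*; x[y-z]≈xy-xz)
  open import Algebra.Properties.AbelianGroup +-abelianGroup using (⁻¹-anti-homo‿-)
  open RingSolver (fromCommutativeRing R (λ _ → nothing)) using (solve; _⊜_; _⊕_; _⊗_; ⊝_)

  Matrix : ℕ → Set c
  Matrix n = Fin n → Fin n → Carrier

  altSum-cong : ∀ {n} {f g : Fin n → Carrier} → (∀ i → f i ≈ g i) → altSum R f ≈ altSum R g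
  altSum-cong {zero}  f≈g = refl
  altSum-cong {suc n} f≈g = +-cong (f≈g zero) (-‿cong (altSum-cong (λ i → f≈g (suc i))))

  altSum-+ : ∀ {n} (f g : Fin n → Carrier) → altSum R (λ i → f i + g i) ≈ altSum R f + altSum R g
  altSum-+ {zero}  f g = sym (+-identityˡ 0#)
  altSum-+ {suc n} f g = begin
      (f zero + g zero) - altSum R (λ i → f (suc i) + g (suc i))
    ≈⟨ +-congˡ (-‿cong (altSum-+ (λ i → f (suc i)) (λ i → g (suc i)))) ⟩
      (f zero + g zero) - (altSum R (λ i → f (suc i)) + altSum R (λ i → g (suc i)))
    ≈⟨ solve 4 (λ a b u v → ((a ⊕ b) ⊕ ⊝ (u ⊕ v)) ⊜ ((a ⊕ ⊝ u) ⊕ (b ⊕ ⊝ v))) refl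
         (f zero) (g zero) (altSum R (λ i → f (suc i))) (altSum R (λ i → g (suc i))) ⟩
      (f zero - altSum R (λ i → f (suc i))) + (g zero - altSum R (λ i → g (suc i))) ∎

  altSum-*ˡ : ∀ {n} (a : Carrier) (f : Fin n → Carrier) → altSum R (λ i → a * f i) ≈ a * altSum R f
  altSum-*ˡ {zero}  a f = sym (zeroʳ a)
  altSum-*ˡ {suc n} a f = begin
      a * f zero - altSum R (λ i → a * f (suc i))
    ≈⟨ +-congˡ (-‿cong (altSum-*ˡ a (λ i → f (suc i)))) ⟩
      a * f zero - a * altSum R (λ i → f (suc i))
    ≈⟨ sym (x[y-z]≈xy-xz a (f zero) (altSum R (λ i → f (suc i)))) ⟩
      a * (f zero - altSum R (λ i → f (suc i))) ∎

  altSum-linear : ∀ {n} (u v : Carrier) (f g : Fin n → Carrier) →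
    altSum R (λ i → u * f i + v * g i) ≈ u * altSum R f + v * altSum R g
  altSum-linear u v f g = trans (altSum-+ (λ i → u * f i) (λ i → v * g i)) (+-cong (altSum-*ˡ u f) (altSum-*ˡ v g))

  sumBits-cong : ∀ {n} {F G : (Fin n → Bool) → Carrier} → (∀ ε → F ε ≈ G ε) → sumBits R F ≈ sumBits R G
  sumBits-cong {zero}  F≈G = F≈G _
  sumBits-cong {suc n} F≈G =
    +-cong (sumBits-cong (λ ε → F≈G (consB false ε))) (sumBits-cong (λ ε → F≈G (consB true ε)))

  sumBits-+ : ∀ {n} (F G : (Fin n → Bool) → Carrier) → sumBits R (λ ε → F ε + G ε) ≈ sumBits R F + sumBits R G
  sumBits-+ {zero}  F G = refl
  sumBits-+ {suc n} F G = begin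
      sumBits R (λ ε → F₀ ε + G₀ ε) + sumBits R (λ ε → F₁ ε + G₁ ε)
    ≈⟨ +-cong (sumBits-+ F₀ G₀) (sumBits-+ F₁ G₁) ⟩
      (sumBits R F₀ + sumBits R G₀) + (sumBits R F₁ + sumBits R G₁)
    ≈⟨ solve 4 (λ a b u v → ((a ⊕ b) ⊕ (u ⊕ v)) ⊜ ((a ⊕ u) ⊕ (b ⊕ v))) refl
         (sumBits R F₀) (sumBits R G₀) (sumBits R F₁) (sumBits R G₁) ⟩
      (sumBits R F₀ + sumBits R F₁) + (sumBits R G₀ + sumBits R G₁) ∎
    where
    F₀ F₁ G₀ G₁ : (Fin n → Bool) → Carrier
    F₀ ε = F (consB false ε)
    F₁ ε = F (consB true ε)
    G₀ ε = G (consB false ε)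
    G₁ ε = G (consB true ε)

  sumBits-*ˡ : ∀ {n} (a : Carrier) (F : (Fin n → Bool) → Carrier) → sumBits R (λ ε → a * F ε) ≈ a * sumBits R F
  sumBits-*ˡ {zero}  a F = refl
  sumBits-*ˡ {suc n} a F =
    trans (+-cong (sumBits-*ˡ a (λ ε → F (consB false ε))) (sumBits-*ˡ a (λ ε → F (consB true ε))))
          (sym (distribˡ a _ _))

  sumBits-*ʳ : ∀ {n} (a : Carrier) (F : (Fin n → Bool) → Carrier) → sumBits R (λ ε → F ε * a) ≈ sumBits R F * a
  sumBits-*ʳ {zero}  a F = refl
  sumBits-*ʳ {suc n} a F =
    trans (+-cong (sumBits-*ʳ a (λ ε → F (consB false ε))) (sumBits-*ʳ a (λ ε → F (consB true ε))))
          (sym (distribʳ a _ _))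

  altSum-sumBits-comm : ∀ {n m} (F : Fin n → (Fin m → Bool) → Carrier) →
    altSum R (λ i → sumBits R (F i)) ≈ sumBits R (λ ε → altSum R (λ i → F i ε))
  altSum-sumBits-comm {m = zero}  F = refl
  altSum-sumBits-comm {m = suc m} F =
    trans (altSum-+ (λ i → sumBits R (λ ε → F i (consB false ε)))
                    (λ i → sumBits R (λ ε → F i (consB true ε))))
          (+-cong (altSum-sumBits-comm (λ i ε → F i (consB false ε)))
                  (altSum-sumBits-comm (λ i ε → F i (consB true ε))))

  det-cong : ∀ {n} {A B : Matrix n} → (∀ r c → A r c ≈ B r c) → det R A ≈ det R B
  det-cong {zero}  A≈B = refl
  det-cong {suc n} A≈B =
    altSum-cong (λ i → *-cong (A≈B i zero) (det-cong (λ r c → A≈B (Fin.punchIn i r) (suc c))))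

  pickColumns : ∀ {n} → (Fin n → Bool) → Matrix n → Matrix n → Matrix n
  pickColumns ε A B r c = if ε c then B r c else A r c

  det-+-columnwise : ∀ {n} (w : Carrier) (A B : Matrix n) →
    det R (λ r c → A r c + w * B r c)
      ≈ sumBits R (λ ε → powℕ R w (weight ε) * det R (pickColumns ε A B))
  det-+-columnwise {zero}  w A B = sym (*-identityˡ 1#)
  det-+-columnwise {suc n} w A B = begin
      altSum R (λ i → (a i + w * b i) * det R (λ r c → A′ i r c + w * B′ i r c))
    ≈⟨ altSum-cong {suc n} (λ i → *-congˡ {a i + w * b i} (det-+-columnwise w (A′ i) (B′ i))) ⟩
      altSum R (λ i → (a i + w * b i) * sumBits R (λ ε → p ε * d i ε))
    ≈⟨ altSum-cong {suc n} (λ i → trans (sym (sumBits-*ˡ (a i + w * b i) (λ ε → p ε * d i ε)))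
                                        (sumBits-cong {n} (λ ε → regroup (a i) (b i) (p ε) (d i ε)))) ⟩
      altSum R (λ i → sumBits R (λ ε → p ε * (a i * d i ε) + (w * p ε) * (b i * d i ε)))
    ≈⟨ altSum-sumBits-comm (λ i ε → p ε * (a i * d i ε) + (w * p ε) * (b i * d i ε)) ⟩
      sumBits R (λ ε → altSum R (λ i → p ε * (a i * d i ε) + (w * p ε) * (b i * d i ε)))
    ≈⟨ sumBits-cong {n} (λ ε → altSum-linear (p ε) (w * p ε) (λ i → a i * d i ε) (λ i → b i * d i ε)) ⟩
      sumBits R (λ ε → p ε * altSum R (λ i → a i * d i ε) + (w * p ε) * altSum R (λ i → b i * d i ε))
    ≈⟨ sumBits-+ (λ ε → p ε * altSum R (λ i → a i * d i ε))
                 (λ ε → (w * p ε) * altSum R (λ i → b i * d i ε)) ⟩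
      sumBits R (λ ε → p ε * altSum R (λ i → a i * d i ε))
        + sumBits R (λ ε → (w * p ε) * altSum R (λ i → b i * d i ε)) ∎
    where
    a b : Fin (suc n) → Carrier
    a i = A i zero
    b i = B i zero
    A′ B′ : Fin (suc n) → Matrix n
    A′ i r c = A (Fin.punchIn i r) (suc c)
    B′ i r c = B (Fin.punchIn i r) (suc c)
    p : (Fin n → Bool) → Carrier
    p ε = powℕ R w (weight ε)
    d : Fin (suc n) → (Fin n → Bool) → Carrier
    d i ε = det R (pickColumns ε (A′ i) (B′ i))
    regroup : ∀ x y u v → (x + w * y) * (u * v) ≈ u * (x * v) + (w * u) * (y * v)
    regroup x y u v =
      solve 5 (λ x y u v w → ((x ⊕ w ⊗ y) ⊗ (u ⊗ v)) ⊜ (u ⊗ (x ⊗ v) ⊕ (w ⊗ u) ⊗ (y ⊗ v))) refl x y u v w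

  powℤ-pred : ∀ {z zinv} → z * zinv ≈ 1# → ∀ e → powℤ R z zinv (e ℤ.- + 1) ≈ zinv * powℤ R z zinv e
  powℤ-pred _ (+ zero) = refl
  powℤ-pred {z} {zinv} z*zinv≈1 (+ suc k) = begin
      powℕ R z k
    ≈⟨ sym (*-identityˡ _) ⟩
      1# * powℕ R z k
    ≈⟨ *-congʳ (trans (sym z*zinv≈1) (*-comm z zinv)) ⟩
      (zinv * z) * powℕ R z k
    ≈⟨ *-assoc zinv z (powℕ R z k) ⟩
      zinv * (z * powℕ R z k) ∎
  -- -[1+ k ] ℤ.+ -[1+ 0 ] normalises to -[1+ suc (k ℕ.+ 0) ], with k ℕ.+ 0 stuck.
  powℤ-pred _ -[1+ k ] rewrite ℕ.+-identityʳ k = refl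

  powℤ-shift : ∀ {z zinv} → z * zinv ≈ 1# → ∀ e →
    powℤ R z zinv e - powℤ R z zinv (e ℤ.- + 2)
      ≈ antisym R z zinv e + (- zinv) * antisym R z zinv (e ℤ.- + 1)
  powℤ-shift {z} {zinv} z*zinv≈1 e = sym (begin
      (P - Q) + (- zinv) * (P′ - Q′)
    ≈⟨ +-congˡ (trans (sym (-‿distribˡ-* zinv (P′ - Q′)))
                (trans (-‿cong (x[y-z]≈xy-xz zinv P′ Q′)) (⁻¹-anti-homo‿- (zinv * P′) (zinv * Q′)))) ⟩
      (P - Q) + (zinv * Q′ - zinv * P′)
    ≈⟨ solve 4 (λ p q a b → ((p ⊕ ⊝ q) ⊕ (b ⊕ ⊝ a)) ⊜ ((p ⊕ ⊝ a) ⊕ (b ⊕ ⊝ q)))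
               refl P Q (zinv * P′) (zinv * Q′) ⟩
      (P - zinv * P′) + (zinv * Q′ - Q)
    ≈⟨ +-cong (+-congˡ (-‿cong (sym (shift (e ℤ.- + 1))))) (+-congʳ (sym (shift (ℤ.- (e ℤ.- + 1))))) ⟩
      (P - pow ((e ℤ.- + 1) ℤ.- + 1)) + (pow (ℤ.- (e ℤ.- + 1) ℤ.- + 1) - Q)
    ≡⟨ ≡.cong₂ (λ s t → (P - pow s) + (pow t - Q)) (pred-pred e) (neg-pred-pred e) ⟩
      (P - pow (e ℤ.- + 2)) + (Q - Q)
    ≈⟨ trans (+-congˡ (-‿inverseʳ Q)) (+-identityʳ _) ⟩
      P - pow (e ℤ.- + 2) ∎)
    where
    pow : ℤ.ℤ → Carrier
    pow = powℤ R z zinv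
    shift : ∀ e → pow (e ℤ.- + 1) ≈ zinv * pow e
    shift = powℤ-pred z*zinv≈1
    P Q P′ Q′ : Carrier
    P = pow e
    Q = pow (ℤ.- e)
    P′ = pow (e ℤ.- + 1)
    Q′ = pow (ℤ.- (e ℤ.- + 1))

  expo-pred : ∀ {N} (μ : Fin N → ℤ.ℤ) j → expo R μ j ℤ.- + 1 ≡ expo R (λ i → μ i ℤ.- + 1) j
  expo-pred {N} μ j = pred-+ (μ j) (+ (N ∸ Fin.toℕ j))

  oddNumMat-split : ∀ {n} (x xinv : Fin n → Carrier) {z zinv : Carrier} → z * zinv ≈ 1# →
    (λ' : Fin (suc n) → ℕ) → ∀ r c →
    oddNumMat R x xinv z zinv λ' r c
      ≈ spNumMat R (snoc x z) (snoc xinv zinv) (λ j → + λ' j) r c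
        + (- zinv) * spNumMat R (snoc x z) (snoc xinv zinv) (λ j → + λ' j ℤ.- + 1) r c
  oddNumMat-split {n} x xinv {z} {zinv} z*zinv≈1 λ' =
    snoc-all₃ Split (λ i c → +-congˡ (trans (-‿distribˡ-* zinv _) (*-congˡ (shifted (x i) (xinv i) c))))
                    (λ c → trans (powℤ-shift z*zinv≈1 (expo R μ c)) (+-congˡ (*-congˡ (shifted z zinv c))))
    where
    μ μ⁻ : Fin (suc n) → ℤ.ℤ
    μ j = + λ' j
    μ⁻ j = + λ' j ℤ.- + 1
    Split : Carrier → Carrier → (Fin (suc n) → Carrier) → Set ℓ
    Split y yinv row = ∀ c → row c ≈ antisym R y yinv (expo R μ c) + (- zinv) * antisym R y yinv (expo R μ⁻ c)
    shifted : ∀ y yinv c → antisym R y yinv (expo R μ c ℤ.- + 1) ≈ antisym R y yinv (expo R μ⁻ c)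
    shifted y yinv c = reflexive (≡.cong (antisym R y yinv) (expo-pred μ c))

  pickColumns-spNumMat : ∀ {N} (y yinv : Fin N → Carrier) (λ' : Fin N → ℕ) ε r c →
    pickColumns ε (spNumMat R y yinv (λ j → + λ' j)) (spNumMat R y yinv (λ j → + λ' j ℤ.- + 1)) r c
      ≈ spNumMat R y yinv (minusBits λ' ε) r c
  pickColumns-spNumMat {N} y yinv λ' ε r c with ε c
  ... | true  = refl
  ... | false =
    reflexive (≡.cong (λ m → antisym R (y r) (yinv r) (m ℤ.+ + (N ∸ Fin.toℕ c))) (≡.sym (ℤ.+-identityʳ (+ λ' c))))

mainTheorem6 : ∀ {c ℓ} (R : CommutativeRing c ℓ) → let open CommutativeRing R in
    (n : ℕ) (x xinv : Fin n → Carrier) (z zinv dinv : Carrier)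
    → (∀ i → x i * xinv i ≈ 1#) → z * zinv ≈ 1#
    → det R (denMat R (snoc x z) (snoc xinv zinv)) * dinv ≈ 1#
    → (λ' : Fin (suc n) → ℕ) → IsPartition λ'
    → oddSpChar R x xinv z zinv dinv λ'
      ≈ sumBits R (λ ε → powℕ R (- zinv) (weight ε)
          * spChar R (snoc x z) (snoc xinv zinv) dinv (minusBits λ' ε))
mainTheorem6 R n x xinv z zinv dinv _ z*zinv≈1 _ λ' _ = begin
    det R (oddNumMat R x xinv z zinv λ') * dinv
  ≈⟨ *-congʳ (det-cong R (oddNumMat-split R x xinv z*zinv≈1 λ')) ⟩
    det R (λ r c → A r c + (- zinv) * B r c) * dinv
  ≈⟨ *-congʳ (det-+-columnwise R (- zinv) A B) ⟩
    sumBits R (λ ε → p ε * det R (pickColumns R ε A B)) * dinv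
  ≈⟨ sumBits-*ʳ R dinv (λ ε → p ε * det R (pickColumns R ε A B)) ⟨
    sumBits R (λ ε → p ε * det R (pickColumns R ε A B) * dinv)
  ≈⟨ sumBits-cong R (λ ε → trans (*-assoc (p ε) _ dinv)
                      (*-congˡ (*-congʳ (det-cong R (pickColumns-spNumMat R Y Yinv λ' ε))))) ⟩
    sumBits R (λ ε → p ε * spChar R Y Yinv dinv (minusBits λ' ε)) ∎
  where
  open CommutativeRing R hiding (zero)
  open import Relation.Binary.Reasoning.Setoid setoid
  Y Yinv : Fin (suc n) → Carrier
  Y = snoc x z
  Yinv = snoc xinv zinv
  A B : Matrix R (suc n)
  A = spNumMat R Y Yinv (λ j → + λ' j)
  B = spNumMat R Y Yinv (λ j → + λ' j ℤ.- + 1)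
  p : (Fin (suc n) → Bool) → Carrier
  p ε = powℕ R (- zinv) (weight ε)
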